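{- For every valuation $v$ over the Nmatrix $\mathcal{M}_{LET_K}$, the map $\rho_v:For(\Sigma)\to\{0,1\}$ given by $\rho_v(A)=v(A)_1$ (the first coordinate of $v(A)$) is a bivaluation for $LET_K$, and for every formula $A$: $\rho_v(A)=1$ if and only if $v(A)\in \mathrm{D}$.
   Context: Fix a denumerable set of propositional variables and let $For(\Sigma)$ be the set of formulas over the signature $\Sigma=\{\land,\lor,\to,\neg,\circ\}$ ($\land,\lor,\to$ binary; $\neg,\circ$ unary). A bivaluation for $LET_K$ is a function $\rho:For(\Sigma)\to\{0,1\}$ such that for all formulas $A,B$: (v1) $\rho(A\land B)=1$ iff $\rho(A)=1$ and $\rho(B)=1$; (v2) $\rho(A\lor B)=1$ iff $\rho(A)=1$ or $\rho(B)=1$; (v3) $\rho(A\to B)=1$ iff $\rho(A)=0$ or $\rho(B)=1$; (v4) $\rho(\neg\neg A)=1$ iff $\rho(A)=1$; (v5) $\rho(\neg(A\land B))=1$ iff $\rho(\neg A)=1$ or $\rho(\neg B)=1$; (v6) $\rho(\neg(A\lor B))=1$ iff $\rho(\neg A)=1$ and $\rho(\neg B)=1$; (v7) $\rho(\neg(A\to B))=1$ iff $\rho(A)=1$ and $\rho(\neg B)=1$; (v8) if $\rho(\circ A)=1$ then ($\rho(\neg A)=1$ iff $\rho(A)=0$). Let $\{0,1\}$ be the two-element Boolean algebra with meet $\sqcap$, join $\sqcup$, complement $\sim$, and $a\Rightarrow b=\sim a\sqcup b$. A non-deterministic matrix (Nmatrix) over a signature is a triple $(M,\mathrm{D},\mathcal{O})$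 with $\emptyset\neq \mathrm{D}\subseteq M$ and $\mathcal{O}$ assigning to each $n$-ary connective $\#$ a function $M^n\to\wp(M)\setminus\{\emptyset\}$; a valuation over it is a map $v$ from formulas to $M$ with $v(\#(A_1,\dots,A_n))\in\mathcal{O}(\#)(v(A_1),\dots,v(A_n))$ for every formula $\#(A_1,\dots,A_n)$. The Nmatrix $\mathcal{M}_{LET_K}$ has domain $B_{LET_K}=\{z=(z_1,z_2,z_3)\in\{0,1\}^3: z_3\le z_1\sqcup z_2 \text{ and } z_1\sqcap z_2\sqcap z_3=0\}$, i.e. the six elements $T=(1,0,1)$, $T_0=(1,0,0)$, $\mathsf{b}=(1,1,0)$, $\mathsf{n}=(0,0,0)$, $F_0=(0,1,0)$, $F=(0,1,1)$; designated set $\mathrm{D}=\{z: z_1=1\}=\{T,T_0,\mathsf{b}\}$; and multioperations (all $u$ ranging over $B_{LET_K}$): $z\tilde\land w=\{u: u_1=z_1\sqcap w_1,\ u_2=z_2\sqcup w_2\}$; $z\tilde\lor w=\{u: u_1=z_1\sqcup w_1,\ u_2=z_2\sqcap w_2\}$; $z\tilde\to w=\{u: u_1=z_1\Rightarrow w_1,\ u_2=z_1\sqcap w_2\}$; $\tilde\neg z=\{u: u_1=z_2,\ u_2=z_1\}$; $\tilde\circ z=\{u: u_1=z_3\}$. -}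

module Defs where

open import Data.Nat using (ℕ)
open import Data.Bool using (Bool; true; false; _∧_; _∨_; not; T)
open import Data.Product using (_×_; _,_; Σ; proj₁)
open import Data.Sum using (_⊎_)
open import Data.Empty using (⊥)
open import Relation.Binary.PropositionalEquality using (_≡_)
open import Function.Bundles using (_⇔_)

data For : Set where
  var  : ℕ → For
  _∧'_ : For → For → For
  _∨'_ : For → For → For
  _⇒'_ : For → For → For
  ¬'_  : For → For
  ∘'_  : For → For

_⇒b_ : Bool → Bool → Bool
a ⇒b b = not a ∨ b

record IsBivaluation (ρ : For → Bool) : Set where
  field
    v1 : ∀ A B → (ρ (A ∧' B) ≡ true) ⇔ (ρ A ≡ true × ρ B ≡ true)
    v2 : ∀ A B → (ρ (A ∨' B) ≡ true) ⇔ (ρ A ≡ true ⊎ ρ B ≡ true)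
    v3 : ∀ A B → (ρ (A ⇒' B) ≡ true) ⇔ (ρ A ≡ false ⊎ ρ B ≡ true)
    v4 : ∀ A → (ρ (¬' (¬' A)) ≡ true) ⇔ (ρ A ≡ true)
    v5 : ∀ A B → (ρ (¬' (A ∧' B)) ≡ true) ⇔ (ρ (¬' A) ≡ true ⊎ ρ (¬' B) ≡ true)
    v6 : ∀ A B → (ρ (¬' (A ∨' B)) ≡ true) ⇔ (ρ (¬' A) ≡ true × ρ (¬' B) ≡ true)
    v7 : ∀ A B → (ρ (¬' (A ⇒' B)) ≡ true) ⇔ (ρ A ≡ true × ρ (¬' B) ≡ true)
    v8 : ∀ A → ρ (∘' A) ≡ true → ((ρ (¬' A) ≡ true) ⇔ (ρ A ≡ false))

-- Domain B_LETK = { (z1,z2,z3) ∈ {0,1}^3 : z3 ≤ z1 ⊔ z2 and z1 ⊓ z2 ⊓ z3 = 0 }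
-- (z3 ≤ z1 ⊔ z2 in the Boolean order is z3 ⇒ (z1 ⊔ z2) = 1)
record BLETK : Set where
  constructor ⟨_,_,_∣_,_⟩
  field
    z1 z2 z3 : Bool
    le   : (z3 ⇒b (z1 ∨ z2)) ≡ true
    meet : (z1 ∧ z2 ∧ z3) ≡ false
open BLETK public

D : BLETK → Set
D z = z1 z ≡ true

-- Multioperations, given as membership predicates  u ∈ op(z , w)
_∈̃∧_,_ : BLETK → BLETK → BLETK → Set
u ∈̃∧ z , w = (z1 u ≡ (z1 z ∧ z1 w)) × (z2 u ≡ (z2 z ∨ z2 w))

_∈̃∨_,_ : BLETK → BLETK → BLETK → Set
u ∈̃∨ z , w = (z1 u ≡ (z1 z ∨ z1 w)) × (z2 u ≡ (z2 z ∧ z2 w))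

_∈̃⇒_,_ : BLETK → BLETK → BLETK → Set
u ∈̃⇒ z , w = (z1 u ≡ (z1 z ⇒b z1 w)) × (z2 u ≡ (z1 z ∧ z2 w))

_∈̃¬_ : BLETK → BLETK → Set
u ∈̃¬ z = (z1 u ≡ z2 z) × (z2 u ≡ z1 z)

_∈̃∘_ : BLETK → BLETK → Set
u ∈̃∘ z = z1 u ≡ z3 z

record IsValuation (v : For → BLETK) : Set where
  field
    val∧ : ∀ A B → v (A ∧' B) ∈̃∧ v A , v B
    val∨ : ∀ A B → v (A ∨' B) ∈̃∨ v A , v B
    val⇒ : ∀ A B → v (A ⇒' B) ∈̃⇒ v A , v B
    val¬ : ∀ A → v (¬' A) ∈̃¬ v A
    val∘ : ∀ A → v (∘' A) ∈̃∘ v A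

ρ : (For → BLETK) → For → Bool
ρ v A = z1 (v A)

-- The first two coordinates of v(A) carry the truth values of A and of ¬A:
-- ρ_v(¬A) = v(A)₂, since ¬̃ swaps the two coordinates.  Each clause of a
-- bivaluation is therefore the truth table of ⊓, ⊔ or ⇒ applied to first or
-- second coordinates, read off from the multioperations.  The only clause that
-- uses the shape of B_LETK is (v8): z₃ = 1 forces exactly one of z₁, z₂ to be 1.
module Submission where

open import Defs
open import Data.Bool using (true; false; _∧_; _∨_)
open import Data.Product using (_×_; _,_; proj₁; proj₂)
open import Data.Sum using (_⊎_; inj₁; inj₂)
open import Relation.Binary.PropositionalEquality using (_≡_; refl; sym; trans; cong₂; module ≡-Reasoning)
open import Function.Bundles using (_⇔_; mk⇔)
import Function.Properties.Equivalence as ⇔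

≡true⇔ : ∀ {x} a → x ≡ a → (x ≡ true) ⇔ (a ≡ true)
≡true⇔ a refl = ⇔.refl

∧≡true⇔ : ∀ {x} a b → x ≡ a ∧ b → (x ≡ true) ⇔ (a ≡ true × b ≡ true)
∧≡true⇔ true  true  refl = mk⇔ (λ _ → refl , refl) (λ _ → refl)
∧≡true⇔ true  false refl = mk⇔ (λ ()) (λ ())
∧≡true⇔ false b     refl = mk⇔ (λ ()) (λ ())

∨≡true⇔ : ∀ {x} a b → x ≡ a ∨ b → (x ≡ true) ⇔ (a ≡ true ⊎ b ≡ true)
∨≡true⇔ true  b     refl = mk⇔ (λ _ → inj₁ refl) (λ _ → refl)
∨≡true⇔ false true  refl = mk⇔ (λ _ → inj₂ refl) (λ _ → refl)
∨≡true⇔ false false refl = mk⇔ (λ ()) (λ { (inj₁ ()) ; (inj₂ ()) })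

⇒b≡true⇔ : ∀ {x} a b → x ≡ a ⇒b b → (x ≡ true) ⇔ (a ≡ false ⊎ b ≡ true)
⇒b≡true⇔ false b     refl = mk⇔ (λ _ → inj₁ refl) (λ _ → refl)
⇒b≡true⇔ true  true  refl = mk⇔ (λ _ → inj₂ refl) (λ _ → refl)
⇒b≡true⇔ true  false refl = mk⇔ (λ ()) (λ { (inj₁ ()) ; (inj₂ ()) })

z2≡true⇔z1≡false : (z : BLETK) → z3 z ≡ true → (z2 z ≡ true) ⇔ (z1 z ≡ false)
z2≡true⇔z1≡false ⟨ true  , true  , true ∣ _  , () ⟩ refl
z2≡true⇔z1≡false ⟨ true  , false , true ∣ _  , _  ⟩ refl = mk⇔ (λ ()) (λ ())
z2≡true⇔z1≡false ⟨ false , true  , true ∣ _  , _  ⟩ refl = mk⇔ (λ _ → refl) (λ _ → refl)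
z2≡true⇔z1≡false ⟨ false , false , true ∣ () , _  ⟩ refl

module _ {v : For → BLETK} (isValuation : IsValuation v) where
  open IsValuation isValuation
  open ≡-Reasoning

  ρ-¬ : ∀ A → ρ v (¬' A) ≡ z2 (v A)
  ρ-¬ A = proj₁ (val¬ A)

  ρ-¬¬ : ∀ A → ρ v (¬' ¬' A) ≡ ρ v A
  ρ-¬¬ A = trans (ρ-¬ (¬' A)) (proj₂ (val¬ A))

  ρ-¬∧ : ∀ A B → ρ v (¬' (A ∧' B)) ≡ ρ v (¬' A) ∨ ρ v (¬' B)
  ρ-¬∧ A B = begin
    ρ v (¬' (A ∧' B))        ≡⟨ ρ-¬ (A ∧' B) ⟩
    z2 (v (A ∧' B))          ≡⟨ proj₂ (val∧ A B) ⟩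
    z2 (v A) ∨ z2 (v B)      ≡⟨ sym (cong₂ _∨_ (ρ-¬ A) (ρ-¬ B)) ⟩
    ρ v (¬' A) ∨ ρ v (¬' B)  ∎

  ρ-¬∨ : ∀ A B → ρ v (¬' (A ∨' B)) ≡ ρ v (¬' A) ∧ ρ v (¬' B)
  ρ-¬∨ A B = begin
    ρ v (¬' (A ∨' B))        ≡⟨ ρ-¬ (A ∨' B) ⟩
    z2 (v (A ∨' B))          ≡⟨ proj₂ (val∨ A B) ⟩
    z2 (v A) ∧ z2 (v B)      ≡⟨ sym (cong₂ _∧_ (ρ-¬ A) (ρ-¬ B)) ⟩
    ρ v (¬' A) ∧ ρ v (¬' B)  ∎

  ρ-¬⇒ : ∀ A B → ρ v (¬' (A ⇒' B)) ≡ ρ v A ∧ ρ v (¬' B)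
  ρ-¬⇒ A B = begin
    ρ v (¬' (A ⇒' B))        ≡⟨ ρ-¬ (A ⇒' B) ⟩
    z2 (v (A ⇒' B))          ≡⟨ proj₂ (val⇒ A B) ⟩
    ρ v A ∧ z2 (v B)         ≡⟨ cong₂ _∧_ refl (sym (ρ-¬ B)) ⟩
    ρ v A ∧ ρ v (¬' B)       ∎

  ρ-∘-consistent : ∀ A → ρ v (∘' A) ≡ true → (ρ v (¬' A) ≡ true) ⇔ (ρ v A ≡ false)
  ρ-∘-consistent A ∘A = ⇔.trans (≡true⇔ (z2 (v A)) (ρ-¬ A))
                                (z2≡true⇔z1≡false (v A) (trans (sym (val∘ A)) ∘A))

  ρ-isBivaluation : IsBivaluation (ρ v)
  ρ-isBivaluation = record
    { v1 = λ A B → ∧≡true⇔ (ρ v A) (ρ v B) (proj₁ (val∧ A B))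
    ; v2 = λ A B → ∨≡true⇔ (ρ v A) (ρ v B) (proj₁ (val∨ A B))
    ; v3 = λ A B → ⇒b≡true⇔ (ρ v A) (ρ v B) (proj₁ (val⇒ A B))
    ; v4 = λ A → ≡true⇔ (ρ v A) (ρ-¬¬ A)
    ; v5 = λ A B → ∨≡true⇔ (ρ v (¬' A)) (ρ v (¬' B)) (ρ-¬∧ A B)
    ; v6 = λ A B → ∧≡true⇔ (ρ v (¬' A)) (ρ v (¬' B)) (ρ-¬∨ A B)
    ; v7 = λ A B → ∧≡true⇔ (ρ v A) (ρ v (¬' B)) (ρ-¬⇒ A B)
    ; v8 = ρ-∘-consistent
    }

proposition2p14 : (v : For → BLETK) → IsValuation v →
    IsBivaluation (ρ v) × (∀ A → (ρ v A ≡ true) ⇔ D (v A))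
proposition2p14 v isValuation = ρ-isBivaluation isValuation , λ A → ⇔.refl
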